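{- Let $I=(A,\succ,c)$ be an SF instance and let $w,w'$ be two stable half-matchings of $I$. Then for every agent $a_i\in A$, $\sum_{a_j\in A,\,j\neq i}w(\{a_i,a_j\})=\sum_{a_j\in A,\,j\neq i}w'(\{a_i,a_j\})$.
   Context: A Stable Fixtures (SF) instance is $I=(A,\succ,c)$ where $A=\{a_1,\dots,a_n\}$ is a finite set of $n$ agents; each agent $a_i$ has a strict linear order $\succ_i$ over $A\setminus\{a_i\}$ (complete preference list), with the convention that every agent ranks itself last; $a\succeq_i b$ means $a\succ_i b$ or $a=b$. Each agent has an integer capacity $c_i$ with $1\le c_i<n$. A half-matching of $I$ is a function $w$ from unordered pairs of distinct agents to $\{0,\tfrac12,1\}$ with $\sum_{j\neq i}w(\{a_i,a_j\})\le c_i$ for all $i$. Agent $a_k$ ranks pairs containing it by the rank of the other agent: $\{a_k,a_l\}\succeq_k\{a_k,a_m\}$ iff $a_l\succeq_k a_m$. $w$ is stable if for every pair $e=\{a_i,a_j\}$ of distinct agents, either $w(e)=1$ or there is $a_k\in e$ with $\sum_{f\ni a_k,\ f\succeq_k e}w(f)=c_k$. -}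

module Defs where

open import Data.Nat using (ℕ; zero; suc; _+_; _*_; _≤_; _<_)
open import Data.Fin using (Fin; zero; suc)
open import Data.Product using (_×_; _,_; Σ)
open import Data.Sum using (_⊎_)
open import Relation.Nullary using (¬_; yes; no)
open import Relation.Nullary.Decidable using (⌊_⌋)
open import Relation.Binary.PropositionalEquality using (_≡_; _≢_)
import Data.Fin.Properties as FinP
import Data.Nat.Properties as NatP

Σ[<_]_ : (n : ℕ) → (Fin n → ℕ) → ℕ
Σ[< zero ] f = 0
Σ[< suc n ] f = f zero + Σ[< n ] (λ j → f (suc j))

-- Preferences: rank i j is the position of agent j in agent i's list (smaller = better).
-- rank i is injective (strict linear order) and i ranks itself last.
record SF (n : ℕ) : Set where
  field
    rank     : Fin n → Fin n → ℕ
    rank-inj : ∀ i j k → rank i j ≡ rank i k → j ≡ k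
    self-last : ∀ i j → j ≢ i → rank i j < rank i i
    cap      : Fin n → ℕ
    cap-pos  : ∀ i → 1 ≤ cap i
    cap-lt   : ∀ i → cap i < n
open SF public

_⪰[_∣_]_ : ∀ {n} → Fin n → SF n → Fin n → Fin n → Set
a ⪰[ I ∣ i ] b = rank I i a ≤ rank I i b

-- Half-matchings represented in units of 1/2: W i j ∈ {0,1,2} means weight W i j / 2
-- on the unordered pair {a_i, a_j}, i ≠ j.  Diagonal values are irrelevant and ignored.
Weights : ℕ → Set
Weights n = Fin n → Fin n → ℕ

load : ∀ {n} → Weights n → Fin n → ℕ
load {n} W i = Σ[< n ] f
  where
  f : Fin n → ℕ
  f j with j FinP.≟ i
  ... | yes _ = 0
  ... | no  _ = W i j

loadAtLeast : ∀ {n} → SF n → Weights n → Fin n → Fin n → ℕ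
loadAtLeast {n} I W k j = Σ[< n ] f
  where
  f : Fin n → ℕ
  f l with l FinP.≟ k
  ... | yes _ = 0
  ... | no  _ with rank I k l NatP.≤? rank I k j
  ...   | yes _ = W k l
  ...   | no  _ = 0

record HalfMatching {n : ℕ} (I : SF n) (W : Weights n) : Set where
  field
    sym     : ∀ i j → i ≢ j → W i j ≡ W j i
    values  : ∀ i j → i ≢ j → W i j ≤ 2
    capOK   : ∀ i → load W i ≤ 2 * cap I i

Stable : ∀ {n} → SF n → Weights n → Set
Stable {n} I W = HalfMatching I W ×
  (∀ i j → i ≢ j →
     W i j ≡ 2
     ⊎ loadAtLeast I W i j ≡ 2 * cap I i
     ⊎ loadAtLeast I W j i ≡ 2 * cap I j)

module Submission where

open import Defs
open import Data.Nat using (ℕ; zero; suc; pred; _+_; _*_; _∸_; _≤_; _<_; z≤n; s≤s; _≤?_; _<?_)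
open import Data.Nat.Properties
open import Data.Nat.Tactic.RingSolver using (solve-∀)
open import Data.Fin using (Fin; zero; suc; punchIn)
open import Data.Fin.Properties using (punchInᵢ≢i; any?)
import Data.Fin.Properties as Finₚ
open import Data.Product using (_,_; proj₁)
open import Data.Sum using (inj₁; inj₂)
open import Function using (_∘_)
open import Function.Definitions using (Injective)
open import Algebra.Properties.Semiring.Sum +-*-semiring
  using (sum; sum-syntax; sum-cong-≗; sum-remove; sum-replicate-zero; ∑-distrib-+; ∑-comm; *-distribˡ-sum)
open import Relation.Binary using (tri<; tri≈; tri>)
open import Relation.Binary.PropositionalEquality
open import Relation.Nullary using (yes; no; contradiction)
open import Relation.Nullary.Decidable using (toWitness; _→-dec_)

-- For an agent k and a partner l, let e_W(k,l) be the amount by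
-- which the weight W places on partners that k strictly prefers to l exceeds 2c_k − 2.
-- If k is saturated at {k,l}, the at most two halves of W(k,l) fill exactly the rest, so
-- stability of W gives W(k,l) + e_W(k,l) + e_W(l,k) ≥ 2 for every pair.  Multiplying by
-- W′(k,l), adding the same with W and W′ swapped and summing over all pairs yields
-- Σ_k (L_k + L′_k) ≤ Σ_k Q_k, where Q_k = Σ_l (W W′ + W′ e_W + W e_W′)(k,l) only involves
-- agent k's own preference list.  Scanning that list, and using that only the last two
-- halves on either side can exceed 2c_k − 2, gives Q_k ≤ pairBound L_k L′_k ≤ L_k + L′_k,
-- with equality only if L_k = L′_k.  So every inequality is tight and L_k = L′_k.

-- pairBound X Y = 2 · min X Y, less one when X = Y is odd.
pairBound : ℕ → ℕ → ℕ
pairBound zero          _             = 0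
pairBound (suc _)       zero          = 0
pairBound 1             1             = 1
pairBound 1             (suc (suc _)) = 2
pairBound (suc (suc _)) 1             = 2
pairBound (suc (suc X)) (suc (suc Y)) = 4 + pairBound X Y

pairBound-sym : ∀ X Y → pairBound X Y ≡ pairBound Y X
pairBound-sym zero          zero          = refl
pairBound-sym zero          (suc _)       = refl
pairBound-sym (suc _)       zero          = refl
pairBound-sym 1             1             = refl
pairBound-sym 1             (suc (suc _)) = refl
pairBound-sym (suc (suc _)) 1             = refl
pairBound-sym (suc (suc X)) (suc (suc Y)) = cong (4 +_) (pairBound-sym X Y)

2*[2+n]≡4+2*n : ∀ n → 2 * (2 + n) ≡ 4 + 2 * n
2*[2+n]≡4+2*n n = *-distribˡ-+ 2 2 n

pairBound≤2* : ∀ X Y → pairBound X Y ≤ 2 * X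
pairBound≤2* zero          _             = z≤n
pairBound≤2* (suc _)       zero          = z≤n
pairBound≤2* 1             1             = s≤s z≤n
pairBound≤2* 1             (suc (suc _)) = ≤-refl
pairBound≤2* (suc (suc X)) 1             = s≤s (s≤s z≤n)
pairBound≤2* (suc (suc X)) (suc (suc Y)) =
  ≤-trans (+-monoʳ-≤ 4 (pairBound≤2* X Y)) (≤-reflexive (sym (2*[2+n]≡4+2*n X)))

pairBound-< : ∀ {X Y} → X < Y → pairBound X Y ≡ 2 * X
pairBound-< {zero}                        _                 = refl
pairBound-< {1}           {1}             (s≤s ())
pairBound-< {1}           {suc (suc _)}   _                 = refl
pairBound-< {suc (suc X)} {suc (suc Y)}   (s≤s (s≤s X<Y))   =
  trans (cong (4 +_) (pairBound-< X<Y)) (sym (2*[2+n]≡4+2*n X))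

2*m<m+n : ∀ {m n} → m < n → 2 * m < m + n
2*m<m+n {m} m<n = +-monoʳ-< m (subst (_< _) (sym (+-identityʳ m)) m<n)

pairBound<+ : ∀ {X Y} → X ≢ Y → pairBound X Y < X + Y
pairBound<+ {X} {Y} X≢Y with <-cmp X Y
... | tri< X<Y _ _ = subst (_< X + Y) (sym (pairBound-< X<Y)) (2*m<m+n X<Y)
... | tri≈ _ X≡Y _ = contradiction X≡Y X≢Y
... | tri> _ _ Y<X = subst₂ _<_ (sym (trans (pairBound-sym X Y) (pairBound-< Y<X))) (+-comm Y X) (2*m<m+n Y<X)

pairBound≤+ : ∀ X Y → pairBound X Y ≤ X + Y
pairBound≤+ X Y with X ≟ Y
... | yes refl = ≤-trans (pairBound≤2* X X) (≤-reflexive (cong (X +_) (+-identityʳ X)))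
... | no X≢Y = <⇒≤ (pairBound<+ X≢Y)

pairBound≡+⇒≡ : ∀ {X Y} → pairBound X Y ≡ X + Y → X ≡ Y
pairBound≡+⇒≡ {X} {Y} eq with X ≟ Y
... | yes X≡Y = X≡Y
... | no X≢Y = contradiction eq (<⇒≢ (pairBound<+ X≢Y))

-- What a partner with weights x, y adds to Q_k when k has capacity d + 1 and already
-- holds X, Y halves from partners it prefers.
crossTerm : ℕ → ℕ → ℕ → ℕ → ℕ → ℕ
crossTerm d X Y x y = x * y + y * (X ∸ 2 * d) + x * (Y ∸ 2 * d)

PairBoundStep : ℕ → ℕ → ℕ → ℕ → ℕ → Set
PairBoundStep d X Y x y = X + x ≤ 2 * suc d → Y + y ≤ 2 * suc d →
  pairBound X Y + crossTerm d X Y x y ≤ pairBound (X + x) (Y + y)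

step-window : ∀ {d} → d < 2 → ∀ {X} → X < 5 → ∀ {Y} → Y < 5 → ∀ {x} → x < 3 → ∀ {y} → y < 3 →
               PairBoundStep d X Y x y
step-window = toWitness {a? = allUpTo? (λ d → allUpTo? (λ X → allUpTo? (λ Y → allUpTo? (λ x → allUpTo? (λ y →
  (X + x ≤? 2 * suc d) →-dec (Y + y ≤? 2 * suc d) →-dec
  (pairBound X Y + crossTerm d X Y x y ≤? pairBound (X + x) (Y + y))) 3) 3) 5) 5) 2} _

step-small : ∀ d X Y x y → d ≤ 1 → x ≤ 2 → y ≤ 2 → PairBoundStep d X Y x y
step-small d X Y x y d≤1 x≤2 y≤2 X+x≤ Y+y≤ =
  step-window (s≤s d≤1) (<5 X+x≤) (<5 Y+y≤) (s≤s x≤2) (s≤s y≤2) X+x≤ Y+y≤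
  where
  <5 : ∀ {Z z} → Z + z ≤ 2 * suc d → Z < 5
  <5 {Z} {z} h = s≤s (≤-trans (m≤m+n Z z) (≤-trans h (*-monoʳ-≤ 2 (s≤s d≤1))))

crossTerm-sym : ∀ d X Y x y → crossTerm d X Y x y ≡ crossTerm d Y X y x
crossTerm-sym d X Y x y = swap x y (X ∸ 2 * d) (Y ∸ 2 * d)
  where
  swap : ∀ x y a b → x * y + y * a + x * b ≡ y * x + x * b + y * a
  swap = solve-∀

step-sym : ∀ d X Y x y → PairBoundStep d Y X y x → PairBoundStep d X Y x y
step-sym d X Y x y step X+x≤ Y+y≤ =
  subst₂ _≤_ (cong₂ _+_ (pairBound-sym Y X) (sym (crossTerm-sym d X Y x y)))
             (pairBound-sym (Y + y) (X + x))
             (step Y+y≤ X+x≤)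

crossTerm-shift : ∀ d X Y x y → crossTerm (suc d) (2 + X) (2 + Y) x y ≡ crossTerm d X Y x y
crossTerm-shift d X Y x y =
  cong₂ (λ a b → x * y + y * a + x * b) (cong ((2 + X) ∸_) (*-suc 2 d)) (cong ((2 + Y) ∸_) (*-suc 2 d))

step-shift : ∀ d X Y x y → PairBoundStep d X Y x y → PairBoundStep (suc d) (2 + X) (2 + Y) x y
step-shift d X Y x y step X+x≤ Y+y≤ =
  subst (λ c → 4 + pairBound X Y + c ≤ 4 + pairBound (X + x) (Y + y)) (sym (crossTerm-shift d X Y x y))
        (+-monoʳ-≤ 4 (step (cancel X+x≤) (cancel Y+y≤)))
  where
  cancel : ∀ {Z} → 2 + Z ≤ 2 * suc (suc d) → Z ≤ 2 * suc d
  cancel h = +-cancelˡ-≤ 2 _ _ (≤-trans h (≤-reflexive (*-suc 2 (suc d))))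

crossTerm-antitone : ∀ {d d′} X Y x y → d ≤ d′ → crossTerm d′ X Y x y ≤ crossTerm d X Y x y
crossTerm-antitone X Y x y d≤d′ =
  +-mono-≤ (+-monoʳ-≤ (x * y) (*-monoʳ-≤ y (∸-monoʳ-≤ X (*-monoʳ-≤ 2 d≤d′))))
           (*-monoʳ-≤ x (∸-monoʳ-≤ Y (*-monoʳ-≤ 2 d≤d′)))

y+[Y∸D]≤2 : ∀ {D Y y} → y ≤ 2 → Y + y ≤ 2 + D → y + (Y ∸ D) ≤ 2
y+[Y∸D]≤2 {D} {Y} {y} y≤2 Y+y≤ with Y ≤? D
... | yes Y≤D = subst (λ t → y + t ≤ 2) (sym (m≤n⇒m∸n≡0 Y≤D)) (≤-trans (≤-reflexive (+-identityʳ y)) y≤2)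
... | no Y≰D = begin
  y + (Y ∸ D)    ≡⟨ +-∸-assoc y (≰⇒≥ Y≰D) ⟨
  (y + Y) ∸ D    ≡⟨ cong (_∸ D) (+-comm y Y) ⟩
  (Y + y) ∸ D    ≤⟨ ∸-monoˡ-≤ D Y+y≤ ⟩
  (2 + D) ∸ D    ≡⟨ m+n∸n≡m 2 D ⟩
  2              ∎
  where open ≤-Reasoning

w+[a∸D]≡2 : ∀ {a w D} → a + w ≡ 2 + D → w ≤ 2 → w + (a ∸ D) ≡ 2
w+[a∸D]≡2 {a} {w} {D} a+w≡2+D w≤2 = begin
  w + (a ∸ D)  ≡⟨ +-∸-assoc w D≤a ⟨
  (w + a) ∸ D  ≡⟨ cong (_∸ D) (trans (+-comm w a) a+w≡2+D) ⟩
  (2 + D) ∸ D  ≡⟨ m+n∸n≡m 2 D ⟩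
  2            ∎
  where
  open ≡-Reasoning
  D≤a : D ≤ a
  D≤a = +-cancelˡ-≤ 2 D a (≤-trans (≤-reflexive (sym a+w≡2+D)) (≤-trans (+-monoʳ-≤ a w≤2) (≤-reflexive (+-comm a 2))))

step-dominated : ∀ d X Y x y → X ≤ 2 * d → X + x < Y + y → y ≤ 2 → Y + y ≤ 2 * suc d →
  pairBound X Y + crossTerm d X Y x y ≤ pairBound (X + x) (Y + y)
step-dominated d X Y x y X≤2d X+x<Y+y y≤2 Y+y≤ = begin
  pairBound X Y + (x * y + y * (X ∸ 2 * d) + x * (Y ∸ 2 * d))
    ≡⟨ cong (λ t → pairBound X Y + (x * y + y * t + x * (Y ∸ 2 * d))) (m≤n⇒m∸n≡0 X≤2d) ⟩
  pairBound X Y + (x * y + y * 0 + x * (Y ∸ 2 * d))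
    ≡⟨ cong (pairBound X Y +_) (factor x y (Y ∸ 2 * d)) ⟩
  pairBound X Y + x * (y + (Y ∸ 2 * d))
    ≤⟨ +-mono-≤ (pairBound≤2* X Y) (*-monoʳ-≤ x (y+[Y∸D]≤2 y≤2 (≤-trans Y+y≤ (≤-reflexive (*-suc 2 d))))) ⟩
  2 * X + x * 2
    ≡⟨ collect X x ⟩
  2 * (X + x)
    ≡⟨ pairBound-< X+x<Y+y ⟨
  pairBound (X + x) (Y + y) ∎
  where
  open ≤-Reasoning
  factor : ∀ x y b → x * y + y * 0 + x * b ≡ x * (y + b)
  factor = solve-∀
  collect : ∀ X x → 2 * X + x * 2 ≡ 2 * (X + x)
  collect = solve-∀

step-edge : ∀ d X Y x y → X ≤ 1 → x ≤ 2 → y ≤ 2 → PairBoundStep (suc d) X Y x y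
step-edge d X Y x y X≤1 x≤2 y≤2 X+x≤ Y+y≤ with X + x <? Y + y
... | yes X+x<Y+y = step-dominated (suc d) X Y x y (≤-trans X≤1 (s≤s z≤n)) X+x<Y+y y≤2 Y+y≤
... | no X+x≮Y+y =
  ≤-trans (+-monoʳ-≤ (pairBound X Y) (crossTerm-antitone X Y x y (s≤s z≤n)))
          (step-small 1 X Y x y ≤-refl x≤2 y≤2 X+x≤4 (≤-trans (≮⇒≥ X+x≮Y+y) X+x≤4))
  where
  X+x≤4 : X + x ≤ 4
  X+x≤4 = ≤-trans (+-mono-≤ X≤1 x≤2) (n≤1+n 3)

-- Shifting d, X and Y by 2 changes neither side beyond adding 4 on both, so only d = 0 and
-- min X Y ≤ 1 remain.  There either X + x < Y + y, and the right side is 2 (X + x), or all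
-- quantities are small enough to check exhaustively.
pairBound-step : ∀ d X Y x y → x ≤ 2 → y ≤ 2 → PairBoundStep d X Y x y
pairBound-step zero    X Y x y x≤2 y≤2 = step-small 0 X Y x y z≤n x≤2 y≤2
pairBound-step (suc d) 0 Y x y x≤2 y≤2 = step-edge d 0 Y x y z≤n x≤2 y≤2
pairBound-step (suc d) 1 Y x y x≤2 y≤2 = step-edge d 1 Y x y ≤-refl x≤2 y≤2
pairBound-step (suc d) X@(suc (suc _)) 0 x y x≤2 y≤2 =
  step-sym (suc d) X 0 x y (step-edge d 0 X y x z≤n y≤2 x≤2)
pairBound-step (suc d) X@(suc (suc _)) 1 x y x≤2 y≤2 =
  step-sym (suc d) X 1 x y (step-edge d 1 X y x ≤-refl y≤2 x≤2)
pairBound-step (suc d) (suc (suc X)) (suc (suc Y)) x y x≤2 y≤2 =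
  step-shift d X Y x y (pairBound-step d X Y x y x≤2 y≤2)

sum-zero : ∀ {n} {f : Fin n → ℕ} → (∀ i → f i ≡ 0) → sum f ≡ 0
sum-zero {n} f≗0 = trans (sum-cong-≗ f≗0) (sum-replicate-zero n)

sum-mono-≤ : ∀ {n} {f g : Fin n → ℕ} → (∀ i → f i ≤ g i) → sum f ≤ sum g
sum-mono-≤ {zero}  _   = z≤n
sum-mono-≤ {suc n} f≤g = +-mono-≤ (f≤g zero) (sum-mono-≤ (f≤g ∘ suc))

≤-sum : ∀ {n} (f : Fin n → ℕ) i → f i ≤ sum f
≤-sum {suc n} f i = ≤-trans (m≤m+n (f i) _) (≤-reflexive (sym (sum-remove {i = i} f)))

sum-agree-off : ∀ {n} {f g : Fin n → ℕ} i → (∀ j → j ≢ i → f j ≡ g j) → f i + sum g ≡ g i + sum f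
sum-agree-off {suc n} {f} {g} i f≡g = begin
  f i + sum g                        ≡⟨ cong (f i +_) (sum-remove {i = i} g) ⟩
  f i + (g i + sum (g ∘ punchIn i))  ≡⟨ swap (f i) (g i) _ ⟩
  g i + (f i + sum (g ∘ punchIn i))  ≡⟨ cong (λ t → g i + (f i + t)) (sum-cong-≗ off) ⟨
  g i + (f i + sum (f ∘ punchIn i))  ≡⟨ cong (g i +_) (sum-remove {i = i} f) ⟨
  g i + sum f                        ∎
  where
  open ≡-Reasoning
  off : ∀ j → f (punchIn i j) ≡ g (punchIn i j)
  off j = f≡g (punchIn i j) (punchInᵢ≢i i j)
  swap : ∀ a b c → a + (b + c) ≡ b + (a + c)
  swap = solve-∀

≤-pointwise∧sum-≥⇒≗ : ∀ {n} {f g : Fin n → ℕ} → (∀ i → f i ≤ g i) → sum g ≤ sum f → ∀ i → f i ≡ g i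
≤-pointwise∧sum-≥⇒≗ {suc n} {f} {g} f≤g Σg≤Σf i = ≤-antisym (f≤g i) (+-cancelʳ-≤ _ _ _ (begin
  g i + sum (g ∘ punchIn i)  ≡⟨ sum-remove {i = i} g ⟨
  sum g                      ≤⟨ Σg≤Σf ⟩
  sum f                      ≡⟨ sum-remove {i = i} f ⟩
  f i + sum (f ∘ punchIn i)  ≤⟨ +-monoʳ-≤ (f i) (sum-mono-≤ (f≤g ∘ punchIn i)) ⟩
  f i + sum (g ∘ punchIn i)  ∎))
  where open ≤-Reasoning

module _ {n} (ρ : Fin n → ℕ) where

  below : ℕ → (Fin n → ℕ) → Fin n → ℕ
  below r g j with ρ j <? r
  ... | yes _ = g j
  ... | no  _ = 0

  prefixSum : ℕ → (Fin n → ℕ) → ℕ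
  prefixSum r g = sum (below r g)

  before : (Fin n → ℕ) → Fin n → ℕ
  before g l = prefixSum (ρ l) g

  prefixSum-zero : ∀ g → prefixSum 0 g ≡ 0
  prefixSum-zero g = sum-zero {n} λ _ → refl

  prefixSum≤sum : ∀ r g → prefixSum r g ≤ sum g
  prefixSum≤sum r g = sum-mono-≤ below≤
    where
    below≤ : ∀ j → below r g j ≤ g j
    below≤ j with ρ j <? r
    ... | yes _ = ≤-refl
    ... | no  _ = z≤n

  prefixSum-all : ∀ {r} g → (∀ j → ρ j < r) → prefixSum r g ≡ sum g
  prefixSum-all {r} g ρ<r = sum-cong-≗ below≡
    where
    below≡ : ∀ j → below r g j ≡ g j
    below≡ j with ρ j <? r
    ... | yes _    = refl
    ... | no  ρj≮r = contradiction (ρ<r j) ρj≮r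

  below-suc-≢ : ∀ {r} g j → ρ j ≢ r → below (suc r) g j ≡ below r g j
  below-suc-≢ {r} g j ρj≢r with ρ j <? suc r | ρ j <? r
  ... | yes _      | yes _    = refl
  ... | yes ρj<1+r | no  ρj≮r = contradiction (≤-antisym (≤-pred ρj<1+r) (≮⇒≥ ρj≮r)) ρj≢r
  ... | no  ρj≮1+r | yes ρj<r = contradiction (m<n⇒m<1+n ρj<r) ρj≮1+r
  ... | no  _      | no  _    = refl

  prefixSum-suc-∉ : ∀ {r} g → (∀ j → ρ j ≢ r) → prefixSum (suc r) g ≡ prefixSum r g
  prefixSum-suc-∉ g ρ≢r = sum-cong-≗ λ j → below-suc-≢ g j (ρ≢r j)

  below-self : ∀ g l → below (ρ l) g l ≡ 0
  below-self g l with ρ l <? ρ l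
  ... | yes ρl<ρl = contradiction ρl<ρl (<-irrefl refl)
  ... | no  _     = refl

  below-suc-self : ∀ g l → below (suc (ρ l)) g l ≡ g l
  below-suc-self g l with ρ l <? suc (ρ l)
  ... | yes _       = refl
  ... | no  ρl≮1+ρl = contradiction (n<1+n (ρ l)) ρl≮1+ρl

  prefixSum-suc : Injective _≡_ _≡_ ρ → ∀ g l → prefixSum (suc (ρ l)) g ≡ prefixSum (ρ l) g + g l
  prefixSum-suc ρ-inj g l = begin
    prefixSum (suc (ρ l)) g                              ≡⟨ cong (_+ prefixSum (suc (ρ l)) g) (below-self g l) ⟨
    below (ρ l) g l + prefixSum (suc (ρ l)) g            ≡⟨ sum-agree-off l off ⟩
    below (suc (ρ l)) g l + prefixSum (ρ l) g            ≡⟨ cong (_+ prefixSum (ρ l) g) (below-suc-self g l) ⟩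
    g l + prefixSum (ρ l) g                              ≡⟨ +-comm (g l) _ ⟩
    prefixSum (ρ l) g + g l                              ∎
    where
    open ≡-Reasoning
    off : ∀ j → j ≢ l → below (ρ l) g j ≡ below (suc (ρ l)) g j
    off j j≢l = sym (below-suc-≢ g j (j≢l ∘ ρ-inj))

  prefix-cross-bound : Injective _≡_ _≡_ ρ → ∀ d (x y : Fin n → ℕ) →
    (∀ l → x l ≤ 2) → (∀ l → y l ≤ 2) → sum x ≤ 2 * suc d → sum y ≤ 2 * suc d →
    sum (λ l → crossTerm d (before x l) (before y l) (x l) (y l)) ≤ pairBound (sum x) (sum y)
  prefix-cross-bound ρ-inj d x y x≤2 y≤2 Σx≤ Σy≤ =
    subst₂ _≤_ (prefixSum-all term ρ<1+Σρ) (cong₂ pairBound (prefixSum-all x ρ<1+Σρ) (prefixSum-all y ρ<1+Σρ))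
           (invariant (suc (sum ρ)))
    where
    term : Fin n → ℕ
    term l = crossTerm d (before x l) (before y l) (x l) (y l)

    ρ<1+Σρ : ∀ j → ρ j < suc (sum ρ)
    ρ<1+Σρ j = s≤s (≤-sum ρ j)

    Invariant : ℕ → Set
    Invariant r = prefixSum r term ≤ pairBound (prefixSum r x) (prefixSum r y)

    fits : ∀ g → sum g ≤ 2 * suc d → ∀ l → before g l + g l ≤ 2 * suc d
    fits g Σg≤ l = ≤-trans (≤-reflexive (sym (prefixSum-suc ρ-inj g l))) (≤-trans (prefixSum≤sum (suc (ρ l)) g) Σg≤)

    add : ∀ l → Invariant (ρ l) → Invariant (suc (ρ l))
    add l inv = begin
      prefixSum (suc (ρ l)) term                     ≡⟨ prefixSum-suc ρ-inj term l ⟩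
      before term l + term l                         ≤⟨ +-monoˡ-≤ (term l) inv ⟩
      pairBound (before x l) (before y l) + term l
        ≤⟨ pairBound-step d _ _ (x l) (y l) (x≤2 l) (y≤2 l) (fits x Σx≤ l) (fits y Σy≤ l) ⟩
      pairBound (before x l + x l) (before y l + y l)
        ≡⟨ cong₂ pairBound (prefixSum-suc ρ-inj x l) (prefixSum-suc ρ-inj y l) ⟨
      pairBound (prefixSum (suc (ρ l)) x) (prefixSum (suc (ρ l)) y) ∎
      where open ≤-Reasoning

    skip : ∀ {r} → (∀ j → ρ j ≢ r) → Invariant r → Invariant (suc r)
    skip ρ≢r = subst₂ _≤_ (sym (prefixSum-suc-∉ term ρ≢r))
                          (sym (cong₂ pairBound (prefixSum-suc-∉ x ρ≢r) (prefixSum-suc-∉ y ρ≢r)))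

    invariant : ∀ r → Invariant r
    invariant zero = ≤-trans (≤-reflexive (prefixSum-zero term)) z≤n
    invariant (suc r) with any? (λ l → ρ l ≟ r)
    ... | yes (l , ρl≡r) = subst (Invariant ∘ suc) ρl≡r (add l (subst Invariant (sym ρl≡r) (invariant r)))
    ... | no  ∄l        = skip (λ j ρj≡r → ∄l (j , ρj≡r)) (invariant r)

Σ[<]≡sum : ∀ {n} (f : Fin n → ℕ) → Σ[< n ] f ≡ sum f
Σ[<]≡sum {zero}  f = refl
Σ[<]≡sum {suc n} f = cong (f zero +_) (Σ[<]≡sum (f ∘ suc))

module _ {n} (I : SF n) where

  -- The diagonal of a Weights value is unconstrained; row zeroes it.
  row : Weights n → Fin n → Fin n → ℕ
  row W k l with l Finₚ.≟ k
  ... | yes _ = 0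
  ... | no  _ = W k l

  -- The summands of load and loadAtLeast are where-bound in Defs and cannot be named, hence
  -- the `_` below; the mutual block lets the first equation of each pair fix it.
  mutual
    load≡sum-row : ∀ W k → load W k ≡ sum (row W k)
    load≡sum-row W k = trans (Σ[<]≡sum {n} _) (sum-cong-≗ (load-summand W k))

    load-summand : ∀ W k j → _ ≡ row W k j
    load-summand W k j with j Finₚ.≟ k
    ... | yes _ = refl
    ... | no  _ = refl

    loadAtLeast≡prefixSum : ∀ W k l →
      loadAtLeast I W k l ≡ prefixSum (rank I k) (suc (rank I k l)) (row W k)
    loadAtLeast≡prefixSum W k l = trans (Σ[<]≡sum {n} _) (sum-cong-≗ (loadAtLeast-summand W k l))

    loadAtLeast-summand : ∀ W k l j → _ ≡ below (rank I k) (suc (rank I k l)) (row W k) j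
    loadAtLeast-summand W k l j with rank I k j <? suc (rank I k l)
    ... | yes ρj<1+ρl with j Finₚ.≟ k
    ...   | yes _ = refl
    ...   | no  _ with rank I k j ≤? rank I k l
    ...     | yes _     = refl
    ...     | no  ρj≰ρl = contradiction (≤-pred ρj<1+ρl) ρj≰ρl
    loadAtLeast-summand W k l j | no ρj≮1+ρl with j Finₚ.≟ k
    ...   | yes _ = refl
    ...   | no  _ with rank I k j ≤? rank I k l
    ...     | yes ρj≤ρl = contradiction (s≤s ρj≤ρl) ρj≮1+ρl
    ...     | no  _     = refl

  row-self : ∀ W k → row W k k ≡ 0
  row-self W k with k Finₚ.≟ k
  ... | yes _   = refl
  ... | no  k≢k = contradiction refl k≢k

  row-off : ∀ W {k l} → l ≢ k → row W k l ≡ W k l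
  row-off W {k} {l} l≢k with l Finₚ.≟ k
  ... | yes l≡k = contradiction l≡k l≢k
  ... | no  _   = refl

  row-sym : ∀ {W} → HalfMatching I W → ∀ k l → row W k l ≡ row W l k
  row-sym hm k l with l Finₚ.≟ k | k Finₚ.≟ l
  ... | yes _   | yes _   = refl
  ... | yes l≡k | no  k≢l = contradiction (sym l≡k) k≢l
  ... | no  l≢k | yes k≡l = contradiction (sym k≡l) l≢k
  ... | no  _   | no  k≢l = HalfMatching.sym hm k l k≢l

  row≤2 : ∀ {W} → HalfMatching I W → ∀ k l → row W k l ≤ 2
  row≤2 hm k l with l Finₚ.≟ k
  ... | yes _   = z≤n
  ... | no  l≢k = HalfMatching.values hm k l (l≢k ∘ sym)

  cap₀ : Fin n → ℕ
  cap₀ k = pred (cap I k)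

  cap≡1+cap₀ : ∀ k → cap I k ≡ suc (cap₀ k)
  cap≡1+cap₀ k with cap I k | cap-pos I k
  ... | suc _ | _ = refl

  sum-row≤ : ∀ {W} → HalfMatching I W → ∀ k → sum (row W k) ≤ 2 * suc (cap₀ k)
  sum-row≤ {W} hm k =
    subst₂ _≤_ (load≡sum-row W k) (cong (2 *_) (cap≡1+cap₀ k)) (HalfMatching.capOK hm k)

  excess : Weights n → Fin n → Fin n → ℕ
  excess W k l = before (rank I k) (row W k) l ∸ 2 * cap₀ k

  cross : Weights n → Weights n → Fin n → Fin n → ℕ
  cross x y k l =
    crossTerm (cap₀ k) (before (rank I k) (row x k) l) (before (rank I k) (row y k) l) (row x k l) (row y k l)

  sum-cross≤pairBound : ∀ {x y} → HalfMatching I x → HalfMatching I y → ∀ k →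
    sum (cross x y k) ≤ pairBound (load x k) (load y k)
  sum-cross≤pairBound {x} {y} hx hy k =
    subst (sum (cross x y k) ≤_) (sym (cong₂ pairBound (load≡sum-row x k) (load≡sum-row y k)))
      (prefix-cross-bound (rank I k) (rank-inj I k _ _) (cap₀ k) (row x k) (row y k)
                          (row≤2 hx k) (row≤2 hy k) (sum-row≤ hx k) (sum-row≤ hy k))

  saturation : Weights n → Fin n → Fin n → ℕ
  saturation W k l = row W k l + excess W k l + excess W l k

  full⇒2≤row+excess : ∀ {W} → HalfMatching I W → ∀ k l →
    loadAtLeast I W k l ≡ 2 * cap I k → 2 ≤ row W k l + excess W k l
  full⇒2≤row+excess {W} hm k l full = ≤-reflexive (sym (w+[a∸D]≡2 (begin
    before (rank I k) (row W k) l + row W k l        ≡⟨ prefixSum-suc (rank I k) (rank-inj I k _ _) (row W k) l ⟨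
    prefixSum (rank I k) (suc (rank I k l)) (row W k) ≡⟨ loadAtLeast≡prefixSum W k l ⟨
    loadAtLeast I W k l                              ≡⟨ full ⟩
    2 * cap I k                                      ≡⟨ cong (2 *_) (cap≡1+cap₀ k) ⟩
    2 * suc (cap₀ k)                                 ≡⟨ *-suc 2 (cap₀ k) ⟩
    2 + 2 * cap₀ k                                   ∎) (row≤2 hm k l)))
    where open ≡-Reasoning

  stable⇒2≤saturation : ∀ {W} → Stable I W → ∀ {k l} → k ≢ l → 2 ≤ saturation W k l
  stable⇒2≤saturation {W} (hm , stable) {k} {l} k≢l with stable k l k≢l
  ... | inj₁ Wkl≡2 =
    ≤-trans (≤-reflexive (sym (trans (row-off W (k≢l ∘ sym)) Wkl≡2))) (≤-trans (m≤m+n _ _) (m≤m+n _ _))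
  ... | inj₂ (inj₁ full-k) = ≤-trans (full⇒2≤row+excess hm k l full-k) (m≤m+n _ _)
  ... | inj₂ (inj₂ full-l) = begin
    2                                        ≤⟨ full⇒2≤row+excess hm l k full-l ⟩
    row W l k + excess W l k                 ≡⟨ cong (_+ excess W l k) (row-sym hm l k) ⟩
    row W k l + excess W l k                 ≤⟨ +-monoˡ-≤ (excess W l k) (m≤m+n _ _) ⟩
    saturation W k l                         ∎
    where open ≤-Reasoning

  2*[x+y]≤weighted-saturation : ∀ {x y} → Stable I x → Stable I y → ∀ k l →
    2 * (row x k l + row y k l) ≤ row y k l * saturation x k l + row x k l * saturation y k l
  2*[x+y]≤weighted-saturation {x} {y} sx sy k l with k Finₚ.≟ l
  ... | yes refl rewrite row-self x k | row-self y k = z≤n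
  ... | no  k≢l  = begin
    2 * (row x k l + row y k l)          ≡⟨ swap (row x k l) (row y k l) ⟩
    row y k l * 2 + row x k l * 2        ≤⟨ +-mono-≤ (*-monoʳ-≤ (row y k l) (stable⇒2≤saturation sx k≢l))
                                                     (*-monoʳ-≤ (row x k l) (stable⇒2≤saturation sy k≢l)) ⟩
    row y k l * saturation x k l + row x k l * saturation y k l ∎
    where
    open ≤-Reasoning
    swap : ∀ a b → 2 * (a + b) ≡ b * 2 + a * 2
    swap = solve-∀

  weighted-saturation≡cross+cross : ∀ {x y} → HalfMatching I x → HalfMatching I y → ∀ k l →
    row y k l * saturation x k l + row x k l * saturation y k l ≡ cross x y k l + cross x y l k
  weighted-saturation≡cross+cross {x} {y} hx hy k l
    rewrite row-sym hx l k | row-sym hy l k =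
    expand (row x k l) (row y k l) (excess x k l) (excess x l k) (excess y k l) (excess y l k)
    where
    expand : ∀ a b e f g h → b * (a + e + f) + a * (b + g + h) ≡ (a * b + b * e + a * g) + (a * b + b * f + a * h)
    expand = solve-∀

  2*load≤sum-cross : ∀ {x y} → Stable I x → Stable I y → ∀ k →
    2 * (load x k + load y k) ≤ ∑[ l < n ] (cross x y k l + cross x y l k)
  2*load≤sum-cross {x} {y} sx sy k = begin
    2 * (load x k + load y k)                      ≡⟨ cong₂ (λ a b → 2 * (a + b)) (load≡sum-row x k) (load≡sum-row y k) ⟩
    2 * (sum (row x k) + sum (row y k))            ≡⟨ cong (2 *_) (∑-distrib-+ (row x k) (row y k)) ⟨
    2 * ∑[ l < n ] (row x k l + row y k l)         ≡⟨ *-distribˡ-sum {n} 2 _ ⟩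
    ∑[ l < n ] (2 * (row x k l + row y k l))       ≤⟨ sum-mono-≤ (2*[x+y]≤weighted-saturation sx sy k) ⟩
    ∑[ l < n ] (row y k l * saturation x k l + row x k l * saturation y k l)
                                                   ≡⟨ sum-cong-≗ (weighted-saturation≡cross+cross (proj₁ sx) (proj₁ sy) k) ⟩
    ∑[ l < n ] (cross x y k l + cross x y l k)     ∎
    where open ≤-Reasoning

  sum-load≤sum-cross : ∀ {x y} → Stable I x → Stable I y →
    ∑[ k < n ] (load x k + load y k) ≤ ∑[ k < n ] sum (cross x y k)
  sum-load≤sum-cross {x} {y} sx sy = *-cancelˡ-≤ 2 (begin
    2 * ∑[ k < n ] (load x k + load y k)                        ≡⟨ *-distribˡ-sum {n} 2 _ ⟩
    ∑[ k < n ] (2 * (load x k + load y k))                      ≤⟨ sum-mono-≤ (2*load≤sum-cross sx sy) ⟩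
    ∑[ k < n ] ∑[ l < n ] (cross x y k l + cross x y l k)       ≡⟨ sum-cong-≗ (λ k → ∑-distrib-+ (cross x y k) _) ⟩
    ∑[ k < n ] (Q k + ∑[ l < n ] cross x y l k)                 ≡⟨ ∑-distrib-+ Q _ ⟩
    ∑[ k < n ] Q k + ∑[ k < n ] ∑[ l < n ] cross x y l k        ≡⟨ cong (∑[ k < n ] Q k +_) (∑-comm (λ k l → cross x y l k)) ⟩
    ∑[ k < n ] Q k + ∑[ l < n ] Q l                             ≡⟨ cong (∑[ k < n ] Q k +_) (+-identityʳ _) ⟨
    2 * ∑[ k < n ] Q k                                          ∎)
    where
    open ≤-Reasoning
    Q : Fin n → ℕ
    Q k = sum (cross x y k)

theorem8 : ∀ {n : ℕ} (I : SF n) (W W′ : Weights n) →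
    Stable I W → Stable I W′ → ∀ (i : Fin n) → load W i ≡ load W′ i
theorem8 {n} I W W′ sW sW′ i = pairBound≡+⇒≡ (≤-pointwise∧sum-≥⇒≗ pairBound≤load+load sum-load≤sum-pairBound i)
  where
  pairBound≤load+load : ∀ k → pairBound (load W k) (load W′ k) ≤ load W k + load W′ k
  pairBound≤load+load k = pairBound≤+ (load W k) (load W′ k)
  sum-load≤sum-pairBound : ∑[ k < n ] (load W k + load W′ k) ≤ ∑[ k < n ] pairBound (load W k) (load W′ k)
  sum-load≤sum-pairBound = ≤-trans (sum-load≤sum-cross I sW sW′)
                                   (sum-mono-≤ (sum-cross≤pairBound I (proj₁ sW) (proj₁ sW′)))
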